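{- Let \(G\) be a graph and let \(H\) be a subgraph of \(G\) isomorphic to the complete graph \(K_n\) for some \(n\geq 4\). Suppose \(D\) is an effective divisor on \(G\) with \(D(q)=0\) for some \(q\in V(H)\), such that \(\sum_{v\in V(H)}D(v)\leq n-1\). If Dhar's burning process is run on \(D\) from \(q\) and not all vertices of \(H\) burn, then either some \(v\in V(H)\) satisfies \(D(v)\geq n-1\), or every \(v\in V(H)\setminus\{q\}\) satisfies \(D(v)\geq 1\). The same conclusion holds if \(n\geq 5\) and \(\sum_{v\in V(H)}D(v)\leq n\).
   Context: Graphs are connected and loopless. A divisor on \(G\) is an element of \(\mathbb{Z}^{V(G)}\) (number of chips on each vertex); it is effective if all entries are nonnegative. Dhar's burning process for a divisor \(D\) with \(D(v)\geq 0\) for all \(v\neq q\), started from \(q\): first \(q\) burns; then repeatedly, every edge incident to a burning vertex burns, and any vertex \(v\neq q\) with strictly more than \(D(v)\) burning incident edges burns; this continues until nothing changes. -}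

module Defs where

open import Data.Nat as ℕ using (ℕ; zero; suc; _+_; _*_; _≥_)
open import Data.Integer as ℤ using (ℤ; +_)
open import Data.Fin using (Fin; zero; suc)
open import Data.Bool using (Bool; true; false; _∨_; if_then_else_)
open import Relation.Nullary.Decidable using (⌊_⌋)
open import Relation.Binary.PropositionalEquality using (_≡_)
open import Data.Product using (∃-syntax)

sumℕ : (k : ℕ) → (Fin k → ℕ) → ℕ
sumℕ zero    f = 0
sumℕ (suc k) f = f zero + sumℕ k (λ i → f (suc i))

sumℤ : (k : ℕ) → (Fin k → ℤ) → ℤ
sumℤ zero    f = + 0
sumℤ (suc k) f = f zero ℤ.+ sumℤ k (λ i → f (suc i))

-- A (multi)graph on vertex set Fin m: mult u v = number of edges between u and v.
-- Connected and loopless, as in the paper's standing assumptions.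
data Reach {m : ℕ} (mult : Fin m → Fin m → ℕ) : Fin m → Fin m → Set where
  here : ∀ {u} → Reach mult u u
  step : ∀ {u v w} → mult u v ≥ 1 → Reach mult v w → Reach mult u w

record Graph (m : ℕ) : Set where
  field
    mult      : Fin m → Fin m → ℕ
    symmetric : ∀ u v → mult u v ≡ mult v u
    loopless  : ∀ v → mult v v ≡ 0
    connected : ∀ u v → Reach mult u v

open Graph public

Divisor : ℕ → Set
Divisor m = Fin m → ℤ

Effective : {m : ℕ} → Divisor m → Set
Effective D = ∀ v → D v ℤ.≥ + 0

-- Number of edges joining v to vertices of the burning set B
-- (these are exactly the burning edges incident to a not-yet-burning v).
burningEdges : {m : ℕ} → Graph m → (Fin m → Bool) → Fin m → ℕ
burningEdges {m} G B v = sumℕ m (λ u → if B u then mult G u v else 0)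

burnStep : {m : ℕ} → Graph m → Divisor m → (Fin m → Bool) → (Fin m → Bool)
burnStep G D B v = B v ∨ ⌊ D v ℤ.<? + burningEdges G B v ⌋

burnSet : {m : ℕ} → Graph m → Divisor m → Fin m → ℕ → (Fin m → Bool)
burnSet G D q zero    v = ⌊ v Data.Fin.≟ q ⌋
burnSet G D q (suc k) = burnStep G D (burnSet G D q k)

Burns : {m : ℕ} → Graph m → Divisor m → Fin m → Fin m → Set
Burns G D q v = ∃[ k ] burnSet G D q k v ≡ true

{-# OPTIONS --safe #-}
-- Suppose no clique vertex holds n − 1 chips and some clique vertex v ≠ q holds none.
-- While c clique vertices burn, every unburnt clique vertex has at least c burning
-- edges, so v catches fire in the first round and from then on c ≥ 2. If the fire
-- stalled with 2 ≤ c < n, each of the u = n − c unburnt clique vertices would hold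
-- at least c chips, and c ≤ n − 2 forces u ≥ 2; the clique would then hold at least
-- c u ≥ 2n − 4 chips, more than n − 1 (for n ≥ 4) and more than n (for n ≥ 5).
-- So the burnt part of the clique grows every round until the whole clique burns.
module Submission where

open import Defs
open import Data.Nat using (ℕ; _≥_; _∸_)
open import Data.Integer using (ℤ; +_; _≤_) renaming (_≥_ to _≥ℤ_)
open import Data.Fin using (Fin)
open import Data.Product using (_×_; ∃-syntax)
open import Data.Sum using (_⊎_)
open import Relation.Nullary using (¬_)
open import Relation.Binary.PropositionalEquality using (_≡_; _≢_)
open import Function.Definitions using (Injective)

open import Data.Nat using (zero; suc; _+_; _*_; z≤n; s≤s; s≤s⁻¹; _≤?_; _<?_)
  renaming (_≤_ to _≤ℕ_; _<_ to _<ℕ_; _≟_ to _≟ℕ_)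
open import Data.Nat.Properties
  using ( ≤-refl; ≤-reflexive; ≤-trans; <-irrefl; <⇒≤; ≰⇒>; ≮⇒≥; <⇒≱; n≢0⇒n>0; m≤m+n; m≤n+m; m<m+n
        ; +-monoʳ-≤; +-mono-≤; +-cancelˡ-≤; +-comm; +-suc; *-zeroʳ; *-identityʳ
        ; +-0-commutativeMonoid; +-*-semiring; module ≤-Reasoning )
open import Data.Nat.Solver using (module +-*-Solver)
import Data.Integer as ℤ
open import Data.Integer.Properties using (0≤i⇒+∣i∣≡i; drop‿+≤+; drop‿+<+)
  renaming (≰⇒> to ℤ-≰⇒>)
open import Data.Fin using (zero; suc; punchIn; punchOut; _≟_)
open import Data.Fin.Properties using (any?; 0≢1+n; suc-injective; punchOut-injective; punchIn-punchOut)
open import Data.Bool using (Bool; true; false; not; if_then_else_)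
open import Data.Bool.Properties using (∨-zeroʳ) renaming (_≟_ to _≟ᵇ_)
open import Data.Vec.Functional using (removeAt)
open import Data.Product using (_,_; map₂)
open import Data.Sum using (inj₁; inj₂) renaming (map to ⊎-map)
open import Function using (_∘_)
open import Relation.Nullary using (yes; no; contradiction)
open import Relation.Nullary.Decidable using (isYes≗does; dec-true; dec-false; ¬?; _×-dec_)
open import Relation.Binary.PropositionalEquality using (refl; sym; trans; cong; subst; subst₂; cong₂)
open import Algebra.Properties.CommutativeMonoid.Sum +-0-commutativeMonoid using (sum; sum-remove; sum-cong-≗)
open import Algebra.Properties.Semiring.Sum +-*-semiring using (*-distribˡ-sum)

sumℕ≡sum : ∀ k (g : Fin k → ℕ) → sumℕ k g ≡ sum g
sumℕ≡sum zero    g = refl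
sumℕ≡sum (suc k) g = cong (_+_ (g zero)) (sumℕ≡sum k (g ∘ suc))

sumℤ-+ : ∀ k (g : Fin k → ℤ) (h : Fin k → ℕ) → (∀ i → g i ≡ + h i) → sumℤ k g ≡ + sumℕ k h
sumℤ-+ zero    g h g≡h = refl
sumℤ-+ (suc k) g h g≡h = cong₂ ℤ._+_ (g≡h zero) (sumℤ-+ k (g ∘ suc) (h ∘ suc) (g≡h ∘ suc))

sum-mono : ∀ {k} {g h : Fin k → ℕ} → (∀ i → g i ≤ℕ h i) → sum g ≤ℕ sum h
sum-mono {zero}  g≤h = z≤n
sum-mono {suc k} g≤h = +-mono-≤ (g≤h zero) (sum-mono (g≤h ∘ suc))

sum∘injective≤sum : ∀ {n m} {f : Fin n → Fin m} → Injective _≡_ _≡_ f →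
                    (g : Fin m → ℕ) → sum (g ∘ f) ≤ℕ sum g
sum∘injective≤sum {zero}          f-inj g = z≤n
sum∘injective≤sum {suc n} {zero}  {f} f-inj g with f zero
... | ()
sum∘injective≤sum {suc n} {suc m} {f} f-inj g = begin
  g (f zero) + sum (g ∘ f ∘ suc)
    ≡⟨ cong (_+_ (g (f zero))) (sum-cong-≗ λ i → cong g (sym (punchIn-punchOut (f0≢ i)))) ⟩
  g (f zero) + sum (removeAt g (f zero) ∘ f′)
    ≤⟨ +-monoʳ-≤ (g (f zero)) (sum∘injective≤sum f′-inj (removeAt g (f zero))) ⟩
  g (f zero) + sum (removeAt g (f zero))
    ≡⟨ sym (sum-remove g) ⟩
  sum g
    ∎
  where
  open ≤-Reasoning
  f0≢ : ∀ i → f zero ≢ f (suc i)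
  f0≢ i = 0≢1+n ∘ f-inj
  f′ : Fin n → Fin m
  f′ i = punchOut (f0≢ i)
  f′-inj : Injective _≡_ _≡_ f′
  f′-inj {i} {j} eq = suc-injective (f-inj (punchOut-injective (f0≢ i) (f0≢ j) eq))

indicator : Bool → ℕ
indicator true  = 1
indicator false = 0

count : ∀ {n} → (Fin n → Bool) → ℕ
count b = sum (indicator ∘ b)

count-removeAt : ∀ {n} (b : Fin (suc n) → Bool) j → count b ≡ indicator (b j) + count (removeAt b j)
count-removeAt b j = sum-remove {i = j} (indicator ∘ b)

indicator-mono : ∀ {x y} → (x ≡ true → y ≡ true) → indicator x ≤ℕ indicator y
indicator-mono {false} x⇒y = z≤n
indicator-mono {true}  x⇒y rewrite x⇒y refl = ≤-refl

count-mono : ∀ {n} {b c : Fin n → Bool} → (∀ i → b i ≡ true → c i ≡ true) → count b ≤ℕ count c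
count-mono b⊆c = sum-mono (λ i → indicator-mono (b⊆c i))

count-strict : ∀ {n} {b c : Fin n → Bool} → (∀ i → b i ≡ true → c i ≡ true) →
               ∀ j → b j ≡ false → c j ≡ true → count b <ℕ count c
count-strict {suc n} {b} {c} b⊆c j bj cj
  rewrite count-removeAt b j | count-removeAt c j | bj | cj = s≤s (count-mono (b⊆c ∘ punchIn j))

count-true⇒pos : ∀ {n} (b : Fin n → Bool) j → b j ≡ true → 0 <ℕ count b
count-true⇒pos {suc n} b j bj rewrite count-removeAt b j | bj = s≤s z≤n

count-complement : ∀ {n} (b : Fin n → Bool) → count b + count (not ∘ b) ≡ n
count-complement {zero}  b = refl
count-complement {suc n} b with b zero
... | true  = cong suc (count-complement (b ∘ suc))
... | false = trans (+-suc (count (b ∘ suc)) _) (cong suc (count-complement (b ∘ suc)))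

count-false⇒<n : ∀ {n} (b : Fin n → Bool) j → b j ≡ false → count b <ℕ n
count-false⇒<n b j bj =
  subst (count b <ℕ_) (count-complement b) (m<m+n (count b) (count-true⇒pos (not ∘ b) j (cong not bj)))

count<n⇒∃false : ∀ {n} (b : Fin n → Bool) → count b <ℕ n → ∃[ j ] b j ≡ false
count<n⇒∃false {suc n} b c<n with b zero in bz
... | false = zero , bz
... | true  with j , bj ← count<n⇒∃false (b ∘ suc) (s≤s⁻¹ c<n) = suc j , bj

*-count-not≤sum : ∀ {n} (b : Fin n → Bool) (d : Fin n → ℕ) {c} →
                  (∀ i → b i ≡ false → c ≤ℕ d i) → c * count (not ∘ b) ≤ℕ sum d
*-count-not≤sum b d {c} large = begin
  c * count (not ∘ b)                      ≡⟨ *-distribˡ-sum c (indicator ∘ not ∘ b) ⟩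
  sum (λ i → c * indicator (not (b i)))    ≤⟨ sum-mono pointwise ⟩
  sum d                                    ∎
  where
  open ≤-Reasoning
  pointwise : ∀ i → c * indicator (not (b i)) ≤ℕ d i
  pointwise i with b i in bi
  ... | true  = ≤-trans (≤-reflexive (*-zeroʳ c)) z≤n
  ... | false = ≤-trans (≤-reflexive (*-identityʳ c)) (large i bi)

FewChips : ℕ → ℕ → Set
FewChips n s = (4 ≤ℕ n × s ≤ℕ n ∸ 1) ⊎ (5 ≤ℕ n × s ≤ℕ n)

cut≤product : ∀ {c u} → 2 ≤ℕ c → 2 ≤ℕ u → (c + u) + (c + u) ≤ℕ 4 + c * u
cut≤product {suc (suc a)} {suc (suc b)} (s≤s (s≤s _)) (s≤s (s≤s _)) =
  subst (_≤ℕ_ (c+u + c+u)) expand (m≤m+n (c+u + c+u) (a * b))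
  where
  open +-*-Solver
  c+u : ℕ
  c+u = (2 + a) + (2 + b)
  expand : c+u + c+u + a * b ≡ 4 + (2 + a) * (2 + b)
  expand = solve 2 (λ a b → ((con 2 :+ a) :+ (con 2 :+ b)) :+ ((con 2 :+ a) :+ (con 2 :+ b)) :+ a :* b
                            := con 4 :+ (con 2 :+ a) :* (con 2 :+ b)) refl a b

¬FewChips : ∀ {n s} → n + n ≤ℕ 4 + s → ¬ FewChips n s
¬FewChips {suc (suc (suc (suc k)))} (s≤s (s≤s (s≤s (s≤s h))))
          (inj₁ (s≤s (s≤s (s≤s (s≤s _))) , s≤n∸1)) =
  <-irrefl refl (≤-trans (m≤n+m (4 + k) k) (≤-trans h s≤n∸1))
¬FewChips {suc (suc (suc (suc (suc k))))} (s≤s (s≤s (s≤s (s≤s h))))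
          (inj₂ (s≤s (s≤s (s≤s (s≤s (s≤s _)))) , s≤n)) =
  <-irrefl refl (≤-trans (s≤s (m≤n+m (5 + k) k)) (≤-trans h s≤n))

<∸1⇒2+≤ : ∀ {a n} → a <ℕ n ∸ 1 → 2 + a ≤ℕ n
<∸1⇒2+≤ {n = suc n} a<n∸1 = s≤s a<n∸1

increasing-below⇒reaches : ∀ n (c : ℕ → ℕ) → (∀ k → c k ≤ℕ c (suc k)) →
                           (∀ k → c k <ℕ n → c k <ℕ c (suc k)) → n ≤ℕ c n
increasing-below⇒reaches n c mono grow = climb n ≤-refl
  where
  climb : ∀ k → k ≤ℕ n → k ≤ℕ c k
  climb zero    _   = z≤n
  climb (suc k) k<n with n ≤? c k
  ... | yes n≤ck = ≤-trans k<n (≤-trans n≤ck (mono k))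
  ... | no  n≰ck = ≤-trans (s≤s (climb k (<⇒≤ k<n))) (grow k (≰⇒> n≰ck))

module _ {m} (G : Graph m) (D : Divisor m) where

  burnStep-extensive : ∀ B v → B v ≡ true → burnStep G D B v ≡ true
  burnStep-extensive B v Bv rewrite Bv = refl

  burnStep-ignites : ∀ B v → D v ℤ.< + burningEdges G B v → burnStep G D B v ≡ true
  burnStep-ignites B v lt with D v ℤ.<? + burningEdges G B v
  ... | yes _  = ∨-zeroʳ (B v)
  ... | no ¬lt = contradiction lt ¬lt

  burnSet-root : ∀ q → burnSet G D q 0 q ≡ true
  burnSet-root q = trans (isYes≗does (q ≟ q)) (dec-true (q ≟ q) refl)

  burnSet-nonroot : ∀ q v → v ≢ q → burnSet G D q 0 v ≡ false
  burnSet-nonroot q v v≢q = trans (isYes≗does (v ≟ q)) (dec-false (v ≟ q) v≢q)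

module CliqueBurning {m n} (G : Graph m) {f : Fin n → Fin m} (f-inj : Injective _≡_ _≡_ f)
                     (clique : ∀ i j → i ≢ j → mult G (f i) (f j) ≥ 1)
                     (D : Divisor m) (eff : Effective D) where

  chips : Fin n → ℕ
  chips i = ℤ.∣ D (f i) ∣

  D≡chips : ∀ i → D (f i) ≡ + chips i
  D≡chips i = sym (0≤i⇒+∣i∣≡i (eff (f i)))

  count≤burningEdges : ∀ B j → B (f j) ≡ false → count (B ∘ f) ≤ℕ burningEdges G B (f j)
  count≤burningEdges B j Bj = begin
    count (B ∘ f)                                  ≤⟨ sum-mono edge-per-burning ⟩
    sum (burning ∘ f)                              ≤⟨ sum∘injective≤sum f-inj burning ⟩
    sum burning                                    ≡⟨ sym (sumℕ≡sum m burning) ⟩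
    burningEdges G B (f j)                         ∎
    where
    open ≤-Reasoning
    burning : Fin m → ℕ
    burning u = if B u then mult G u (f j) else 0
    edge-per-burning : ∀ i → indicator (B (f i)) ≤ℕ burning (f i)
    edge-per-burning i with B (f i) in Bi
    ... | false = z≤n
    ... | true  = clique i j λ { refl → contradiction (trans (sym Bi) Bj) λ () }

  clique-ignites : ∀ B j → B (f j) ≡ false → chips j <ℕ count (B ∘ f) →
                   burnStep G D B (f j) ≡ true
  clique-ignites B j Bj lt = burnStep-ignites G D B (f j)
    (subst (ℤ._< + burningEdges G B (f j)) (sym (D≡chips j))
           (ℤ.+<+ (≤-trans lt (count≤burningEdges B j Bj))))

  module _ (small : ∀ i → 2 + chips i ≤ℕ n) (few : FewChips n (sum chips)) where

    clique-spreads : ∀ B → 2 ≤ℕ count (B ∘ f) → count (B ∘ f) <ℕ n →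
                     count (B ∘ f) <ℕ count (burnStep G D B ∘ f)
    clique-spreads B 2≤c c<n with any? (λ j → (B (f j) ≟ᵇ false) ×-dec (chips j <? count (B ∘ f)))
    ... | yes (j , Bj , lt) =
      count-strict (λ i → burnStep-extensive G D B (f i)) j Bj (clique-ignites B j Bj lt)
    ... | no ¬ignites = contradiction few (¬FewChips (begin
      n + n                 ≡⟨ cong (λ k → k + k) (sym (count-complement (B ∘ f))) ⟩
      (c + u) + (c + u)     ≤⟨ cut≤product 2≤c 2≤u ⟩
      4 + c * u             ≤⟨ +-monoʳ-≤ 4 (*-count-not≤sum (B ∘ f) chips unburnt-loaded) ⟩
      4 + sum chips         ∎))
      where
      open ≤-Reasoning
      c u : ℕ
      c = count (B ∘ f)
      u = count (not ∘ B ∘ f)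
      unburnt-loaded : ∀ j → B (f j) ≡ false → c ≤ℕ chips j
      unburnt-loaded j Bj = ≮⇒≥ λ lt → ¬ignites (j , Bj , lt)
      2≤u : 2 ≤ℕ u
      2≤u with j , Bj ← count<n⇒∃false (B ∘ f) c<n =
        +-cancelˡ-≤ c 2 u (subst₂ _≤ℕ_ (+-comm 2 c) (sym (count-complement (B ∘ f)))
                                       (≤-trans (+-monoʳ-≤ 2 (unburnt-loaded j Bj)) (small j)))

    clique-burns : ∀ q iq → f iq ≡ q → ∀ v → f v ≢ q → chips v ≡ 0 →
                   ∀ i → Burns G D q (f i)
    clique-burns q iq fiq≡q v fv≢q v-empty i with burnSet G D q (suc n) (f i) in burnt-i
    ... | true  = suc n , burnt-i
    ... | false = contradiction everything-burnt (<⇒≱ (count-false⇒<n _ i burnt-i))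
      where
      burnt : ℕ → ℕ
      burnt k = count (λ i → burnSet G D q k (f i))
      burnt-mono : ∀ k → burnt k ≤ℕ burnt (suc k)
      burnt-mono k = count-mono (λ i → burnStep-extensive G D (burnSet G D q k) (f i))
      v-unburnt : burnSet G D q 0 (f v) ≡ false
      v-unburnt = burnSet-nonroot G D q (f v) fv≢q
      root-burnt : 0 <ℕ burnt 0
      root-burnt = count-true⇒pos _ iq
        (subst (λ u → burnSet G D q 0 u ≡ true) (sym fiq≡q) (burnSet-root G D q))
      two-burnt : ∀ k → 2 ≤ℕ burnt (suc k)
      two-burnt zero    = ≤-trans (s≤s root-burnt)
        (count-strict (λ i → burnStep-extensive G D _ (f i)) v v-unburnt
                      (clique-ignites _ v v-unburnt (subst (_<ℕ burnt 0) (sym v-empty) root-burnt)))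
      two-burnt (suc k) = ≤-trans (two-burnt k) (burnt-mono (suc k))
      everything-burnt : n ≤ℕ burnt (suc n)
      everything-burnt = increasing-below⇒reaches n (burnt ∘ suc) (burnt-mono ∘ suc)
                           (λ k → clique-spreads (burnSet G D q (suc k)) (two-burnt k))

lemma2p5 : (m : ℕ) (G : Graph m) (n : ℕ)
    → (f : Fin n → Fin m) → Injective _≡_ _≡_ f
    → (∀ i j → i ≢ j → mult G (f i) (f j) ≥ 1)
    → (D : Divisor m) → Effective D
    → (q : Fin m) → (∃[ i ] f i ≡ q) → D q ≡ + 0
    → ((n ≥ 4 × sumℤ n (λ i → D (f i)) ≤ + (n ∸ 1))
    ⊎ (n ≥ 5 × sumℤ n (λ i → D (f i)) ≤ + n))
    → (∃[ i ] ¬ Burns G D q (f i))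
    → (∃[ i ] D (f i) ≥ℤ + (n ∸ 1))
    ⊎ (∀ i → f i ≢ q → D (f i) ≥ℤ + 1)
lemma2p5 m G n f f-inj clique D eff q (iq , fiq≡q) _ few (i , ¬burns)
  with any? (λ i → + (n ∸ 1) ℤ.≤? D (f i))
     | any? (λ v → ¬? (f v ≟ q) ×-dec (ℤ.∣ D (f v) ∣ ≟ℕ 0))
... | yes big | _ = inj₁ big
... | no ¬big | no ¬empty = inj₂ λ v fv≢q →
  subst (+ 1 ℤ.≤_) (sym (D≡chips v)) (ℤ.+≤+ (n≢0⇒n>0 λ v-empty → ¬empty (v , fv≢q , v-empty)))
  where open CliqueBurning G f-inj clique D eff
... | no ¬big | yes (v , fv≢q , v-empty) =
  contradiction (clique-burns small few-chips q iq fiq≡q v fv≢q v-empty i) ¬burns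
  where
  open CliqueBurning G f-inj clique D eff
  small : ∀ i → 2 + chips i ≤ℕ n
  small i = <∸1⇒2+≤ (drop‿+<+
    (subst (ℤ._< + (n ∸ 1)) (D≡chips i) (ℤ-≰⇒> λ big → ¬big (i , big))))
  few-chips : FewChips n (sum chips)
  few-chips rewrite sumℤ-+ n (D ∘ f) chips D≡chips | sumℕ≡sum n chips =
    ⊎-map (map₂ drop‿+≤+) (map₂ drop‿+≤+) few
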